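{- A graph $G$ has exactly one Grundy total dominating set (i.e., $G$ is a unique Grundy total domination graph) if and only if $\gamma_{gr}^{t}(G)=n(G)-i(G)$.
   Context: For a vertex $v$, $N(v)$ is its open neighborhood. An open neighborhood sequence of $G$ is a sequence $(v_1,\ldots,v_k)$ of distinct vertices such that for each $i\in[k]$, $N(v_i)\setminus\bigcup_{j=1}^{i-1}N(v_j)\neq\emptyset$. $\gamma_{gr}^{t}(G)$ is the maximum length of an open neighborhood sequence, and a Grundy total dominating set is the set of vertices of such a maximum-length sequence. $n(G)$ is the number of vertices and $i(G)$ the number of isolated vertices of $G$. -}

module Defs where

open import Data.Nat using (ℕ; _≤_; _∸_)
open import Data.Bool using (Bool; true; false; not)
open import Data.Fin using (Fin)
open import Data.Fin.Subset using (Subset) renaming (_∈_ to _∈ₛ_)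
open import Data.List using (List; []; _∷_; _++_; [_]; length; filter; allFin)
open import Data.List.Relation.Unary.All using (All)
open import Data.List.Relation.Unary.Unique.Propositional using (Unique)
open import Data.List.Membership.Propositional using (_∈_)
open import Data.Product using (Σ; ∃; _×_)
open import Data.Unit using (⊤)
open import Relation.Binary.PropositionalEquality using (_≡_)
open import Relation.Nullary.Decidable using (does)
import Data.Bool.Properties
import Data.Fin.Properties
open import Relation.Nullary using (Dec)
open import Function.Bundles using (_⇔_)

record Graph (n : ℕ) : Set where
  field
    adj    : Fin n → Fin n → Bool
    sym    : ∀ u v → adj u v ≡ adj v u
    irrefl : ∀ v → adj v v ≡ false
open Graph public

module _ {n : ℕ} (G : Graph n) where

  InN : Fin n → Fin n → Set
  InN v u = adj G v u ≡ true

  Footprint : List (Fin n) → Fin n → Set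
  Footprint prev v = ∃ λ u → InN v u × All (λ w → adj G w u ≡ false) prev

  ONSFrom : List (Fin n) → List (Fin n) → Set
  ONSFrom prev []       = ⊤
  ONSFrom prev (v ∷ vs) = Footprint prev v × ONSFrom (prev ++ [ v ]) vs

  IsONS : List (Fin n) → Set
  IsONS s = Unique s × ONSFrom [] s

  IsGrundyTotalDomNumber : ℕ → Set
  IsGrundyTotalDomNumber k =
    (∃ λ s → IsONS s × length s ≡ k) × (∀ s → IsONS s → length s ≤ k)

  IsMaxONS : List (Fin n) → Set
  IsMaxONS s = IsONS s × (∀ s' → IsONS s' → length s' ≤ length s)

  IsGrundyTotalDomSet : Subset n → Set
  IsGrundyTotalDomSet S = ∃ λ s → IsMaxONS s × (∀ v → (v ∈ₛ S) ⇔ (v ∈ s))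

  UniqueGTD : Set
  UniqueGTD = ∃ λ S → IsGrundyTotalDomSet S × (∀ S' → IsGrundyTotalDomSet S' → S' ≡ S)

  IsIsolated : Fin n → Set
  IsIsolated v = ∀ u → adj G v u ≡ false

  isIsolated? : ∀ v → Dec (IsIsolated v)
  isIsolated? v = Data.Fin.Properties.all? (λ u → adj G v u Data.Bool.Properties.≟ false)

  numIsolated : ℕ
  numIsolated = length (filter isIsolated? (allFin n))

-- Every vertex of an open neighbourhood sequence has a neighbour, so such a
-- sequence uses only non-isolated vertices and γ_gr^t(G) ≤ n(G) − i(G).  If
-- equality holds, every maximum sequence consists of all non-isolated vertices,
-- so the Grundy total dominating set is unique.  Conversely, if (v₁,…,v_k) is
-- a sequence with footprints u_i ∈ N(v_i) ∖ ⋃_{j<i} N(v_j), then (u_k,…,u_1)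
-- is a sequence with footprints v_k,…,v_1.  Choosing as footprint a given
-- vertex y dominated by a maximum sequence, y itself lies in a maximum
-- sequence.  Every non-isolated x has a neighbour u that is dominated (else x
-- could be appended), so applying this twice puts x into a maximum sequence.
-- Uniqueness of the set then forces all non-isolated vertices into it.
module Submission where

open import Defs
open import Data.Nat using (ℕ; suc; _+_; _∸_; _≤_; z≤n; s≤s)
open import Data.Nat.Properties using (≤-trans; ≤-reflexive; ≤-antisym; 1+n≰n; +-comm; +-suc; m+n∸m≡n)
open import Data.Bool using (true; false)
open import Data.Bool.Properties using (_≟_; ¬-not)
open import Data.Fin using (Fin)
import Data.Fin.Properties as Fin
open import Data.Fin.Subset using (Subset) renaming (_∈_ to _∈ₛ_)
open import Data.Fin.Subset.Properties using (⊆-antisym)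
open import Data.List using (List; []; _∷_; _++_; [_]; length; filter; allFin; map; reverse)
open import Data.List.Properties
  using (++-assoc; ++-identityʳ; unfold-reverse; length-++; length-++-sucʳ; length-map; length-reverse; length-tabulate)
open import Data.List.Relation.Unary.All as All using (All; []; _∷_)
import Data.List.Relation.Unary.All.Properties as All
open import Data.List.Relation.Unary.Any as Any using (Any; here; there; any?)
import Data.List.Relation.Unary.Any.Properties as Any
open import Data.List.Relation.Unary.AllPairs as AllPairs using (AllPairs; []; _∷_)
import Data.List.Relation.Unary.AllPairs.Properties as AllPairs
open import Data.List.Relation.Unary.Unique.Propositional using (Unique)
import Data.List.Relation.Unary.Unique.Propositional.Properties as Unique
open import Data.List.Membership.Propositional using (_∈_; _∉_)
open import Data.List.Membership.Propositional.Properties using (∈-∃++; ∈-++⁺ˡ; ∈-++⁺ʳ; ∈-filter⁺; ∈-filter⁻; ∈-allFin)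
open import Data.List.Relation.Binary.Subset.Propositional using (_⊆_)
open import Data.Product as Product using (∃; _×_; _,_; proj₁; proj₂; swap)
open import Data.Unit using (tt)
open import Data.Vec using (tabulate; lookup)
open import Data.Vec.Properties using (lookup⇒[]=; []=⇒lookup; lookup∘tabulate)
open import Function using (_∘_; flip)
open import Function.Bundles using (_⇔_; mk⇔; Equivalence)
import Function.Properties.Equivalence as ⇔
open import Relation.Binary.Core using (Rel)
open import Relation.Binary.Definitions using (DecidableEquality)
import Relation.Binary.PropositionalEquality as ≡
open ≡ using (_≡_; _≢_; refl; trans; cong; subst)
open ≡.≡-Reasoning
open import Relation.Nullary using (¬_; Dec; yes; no; contradiction)
open import Relation.Nullary.Decidable using (does; dec-true)
open import Relation.Unary using (Pred; Decidable)
open import Relation.Unary.Properties using (∁?)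

module _ {a} {A : Set a} where

  ∈-remove : ∀ as {bs : List A} {x y} → y ∈ as ++ x ∷ bs → y ≢ x → y ∈ as ++ bs
  ∈-remove []       (here y≡x)   y≢x = contradiction y≡x y≢x
  ∈-remove []       (there y∈bs) _   = y∈bs
  ∈-remove (_ ∷ _)  (here y≡a)   _   = here y≡a
  ∈-remove (_ ∷ as) (there y∈)   y≢x = there (∈-remove as y∈ y≢x)

  Unique-⊆⇒length≤ : ∀ {xs ys : List A} → Unique xs → xs ⊆ ys → length xs ≤ length ys
  Unique-⊆⇒length≤ {[]}     _                 _     = z≤n
  Unique-⊆⇒length≤ {x ∷ xs} (x≢xs ∷ xs-unique) xs⊆ys with as , bs , refl ← ∈-∃++ (xs⊆ys (here refl)) =
    ≤-trans (s≤s (Unique-⊆⇒length≤ xs-unique xs⊆as++bs)) (≤-reflexive (≡.sym (length-++-sucʳ as x bs)))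
    where
    xs⊆as++bs : xs ⊆ as ++ bs
    xs⊆as++bs z∈xs = ∈-remove as (xs⊆ys (there z∈xs)) (≡.≢-sym (All.lookup x≢xs z∈xs))

  Unique-⊆-length≥⇒⊇ : DecidableEquality A → ∀ {xs ys : List A} →
                       Unique ys → ys ⊆ xs → length xs ≤ length ys → xs ⊆ ys
  Unique-⊆-length≥⇒⊇ _≟ₐ_ {xs} {ys} ys-unique ys⊆xs xs≤ys {x} x∈xs with any? (x ≟ₐ_) ys
  ... | yes x∈ys = x∈ys
  ... | no  x∉ys = contradiction (≤-trans (s≤s xs≤ys) (Unique-⊆⇒length≤ x∷ys-unique x∷ys⊆xs)) 1+n≰n
    where
    x∷ys-unique : Unique (x ∷ ys)
    x∷ys-unique = All.¬Any⇒All¬ ys x∉ys ∷ ys-unique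
    x∷ys⊆xs : x ∷ ys ⊆ xs
    x∷ys⊆xs (here refl)  = x∈xs
    x∷ys⊆xs (there z∈ys) = ys⊆xs z∈ys

  length-filter+length-filter-∁ : ∀ {p} {P : Pred A p} (P? : Decidable P) xs →
                                  length (filter P? xs) + length (filter (∁? P?) xs) ≡ length xs
  length-filter+length-filter-∁ P? []       = refl
  length-filter+length-filter-∁ P? (x ∷ xs) with P? x
  ... | yes _ = cong suc (length-filter+length-filter-∁ P? xs)
  ... | no  _ = trans (+-suc _ _) (cong suc (length-filter+length-filter-∁ P? xs))

  All-reverse⁺ : ∀ {p} {P : Pred A p} {xs} → All P xs → All P (reverse xs)
  All-reverse⁺ {xs = []}     []         = []
  All-reverse⁺ {xs = x ∷ xs} (px ∷ pxs) rewrite unfold-reverse x xs = All.∷ʳ⁺ (All-reverse⁺ pxs) px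

  AllPairs-reverse⁺ : ∀ {r} {R : Rel A r} {xs} → AllPairs R xs → AllPairs (flip R) (reverse xs)
  AllPairs-reverse⁺ {xs = []}     []           = []
  AllPairs-reverse⁺ {xs = x ∷ xs} (rx ∷ rxs) rewrite unfold-reverse x xs =
    AllPairs.++⁺ (AllPairs-reverse⁺ rxs) ([] ∷ []) (All.map (_∷ []) (All-reverse⁺ rx))

does≡true⇒ : ∀ {p} {P : Set p} (P? : Dec P) → does P? ≡ true → P
does≡true⇒ (yes p) _  = p
does≡true⇒ (no _)  ()

module _ {n : ℕ} where

  toSubset : List (Fin n) → Subset n
  toSubset s = tabulate (λ v → does (any? (v Fin.≟_) s))

  ∈-toSubset : ∀ s v → v ∈ₛ toSubset s ⇔ v ∈ s
  ∈-toSubset s v = mk⇔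
    (λ v∈S → does≡true⇒ (any? (v Fin.≟_) s) (trans (≡.sym lookup-v) ([]=⇒lookup v∈S)))
    (λ v∈s → lookup⇒[]= v (toSubset s) (trans lookup-v (dec-true (any? (v Fin.≟_) s) v∈s)))
    where
    lookup-v : lookup (toSubset s) v ≡ does (any? (v Fin.≟_) s)
    lookup-v = lookup∘tabulate _ v

  Subset-≡ : ∀ {S T : Subset n} → (∀ v → v ∈ₛ S ⇔ v ∈ₛ T) → S ≡ T
  Subset-≡ S⇔T = ⊆-antisym (λ {v} → Equivalence.to (S⇔T v)) (λ {v} → Equivalence.from (S⇔T v))

module _ {n : ℕ} (G : Graph n) where

  Undominated : List (Fin n) → Fin n → Set
  Undominated prev u = All (λ w → adj G w u ≡ false) prev

  footprint⇒¬isolated : ∀ {prev v} → Footprint G prev v → ¬ IsIsolated G v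
  footprint⇒¬isolated (u , vu , _) v-isolated = contradiction (trans (≡.sym vu) (v-isolated u)) λ ()

  footprint⇒∉ : ∀ {prev v} → Footprint G prev v → v ∉ prev
  footprint⇒∉ (u , vu , u-undominated) v∈prev =
    contradiction (trans (≡.sym vu) (All.lookup u-undominated v∈prev)) λ ()

  ONSFrom⇒¬isolated : ∀ {prev} s → ONSFrom G prev s → All (¬_ ∘ IsIsolated G) s
  ONSFrom⇒¬isolated []       _           = []
  ONSFrom⇒¬isolated (_ ∷ vs) (fp , rest) = footprint⇒¬isolated fp ∷ ONSFrom⇒¬isolated vs rest

  ONSFrom⇒fresh : ∀ {prev} s → ONSFrom G prev s → All (_∉ prev) s
  ONSFrom⇒fresh []       _           = []
  ONSFrom⇒fresh (_ ∷ vs) (fp , rest) = footprint⇒∉ fp ∷ All.map (_∘ ∈-++⁺ˡ) (ONSFrom⇒fresh vs rest)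

  ONSFrom⇒Unique : ∀ {prev} s → ONSFrom G prev s → Unique s
  ONSFrom⇒Unique         []       _          = []
  ONSFrom⇒Unique {prev} (_ ∷ vs) (_ , rest) =
    All.map (λ w∉ v≡w → w∉ (∈-++⁺ʳ prev (here (≡.sym v≡w)))) (ONSFrom⇒fresh vs rest) ∷ ONSFrom⇒Unique vs rest

  ONSFrom-++-[] : ∀ {prev} s {x} → ONSFrom G prev s → Footprint G (prev ++ s) x → ONSFrom G prev (s ++ [ x ])
  ONSFrom-++-[] {prev} []       _           fp = subst (λ l → Footprint G l _) (++-identityʳ prev) fp , tt
  ONSFrom-++-[] {prev} (v ∷ vs) (fv , rest) fp =
    fv , ONSFrom-++-[] vs rest (subst (λ l → Footprint G l _) (≡.sym (++-assoc prev [ v ] vs)) fp)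

  maxONS⇒¬footprint : ∀ {s x} → IsMaxONS G s → ¬ Footprint G s x
  maxONS⇒¬footprint {s} {x} ((_ , s-ons) , s-max) fp =
    1+n≰n (≤-trans (≤-reflexive (≡.sym length-s++x)) (s-max (s ++ [ x ]) (ONSFrom⇒Unique _ s++x-ons , s++x-ons)))
    where
    s++x-ons : ONSFrom G [] (s ++ [ x ])
    s++x-ons = ONSFrom-++-[] s s-ons fp
    length-s++x : length (s ++ [ x ]) ≡ suc (length s)
    length-s++x = trans (length-++ s) (+-comm (length s) 1)

  -- A pair (v , u) stands for a vertex v of a sequence together with a chosen footprint u.
  HasFootprint : Fin n × Fin n → Set
  HasFootprint (v , u) = InN G v u

  Misses : Fin n × Fin n → Fin n × Fin n → Set
  Misses (v , _) (_ , u) = adj G v u ≡ false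

  IsFootprintList : List (Fin n × Fin n) → Set
  IsFootprintList ps = All HasFootprint ps × AllPairs Misses ps

  FootprintListOf : List (Fin n) → List (Fin n) → List (Fin n × Fin n) → Set
  FootprintListOf prev s ps = map proj₁ ps ≡ s × IsFootprintList ps × All (Undominated prev ∘ proj₂) ps

  FootprintListOf-∷ : ∀ {prev v vs u ps} → InN G v u → Undominated prev u →
                      FootprintListOf (prev ++ [ v ]) vs ps → FootprintListOf prev (v ∷ vs) ((v , u) ∷ ps)
  FootprintListOf-∷ {prev} vu u-undominated (refl , (fps , misses) , undominated) =
      refl
    , (vu ∷ fps , All.map (All.head ∘ All.++⁻ʳ prev) undominated ∷ misses)
    , u-undominated ∷ All.map (All.++⁻ˡ prev) undominated

  footprintList : ∀ {prev} s → ONSFrom G prev s → ∃ (FootprintListOf prev s)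
  footprintList []       _                                = [] , refl , ([] , []) , []
  footprintList (v ∷ vs) ((u , vu , u-undominated) , rest) =
    Product.map ((v , u) ∷_) (FootprintListOf-∷ vu u-undominated) (footprintList vs rest)

  -- The first vertex of s adjacent to y may take y as its footprint.
  footprintList-through : ∀ {prev} s {y} → ONSFrom G prev s → Undominated prev y →
                          Any (λ v → InN G v y) s → ∃ λ ps → FootprintListOf prev s ps × y ∈ map proj₂ ps
  footprintList-through (v ∷ vs) {y} (_ , rest) y-undominated y-dominated with adj G v y ≟ true
  ... | yes vy = Product.map ((v , y) ∷_) (λ fl → FootprintListOf-∷ vy y-undominated fl , here refl)
                             (footprintList vs rest)
  footprintList-through (v ∷ vs) _ _ (here vy) | no ¬vy = contradiction vy ¬vy
  footprintList-through (v ∷ vs) ((u , vu , u-undominated) , rest) y-undominated (there y-dominated) | no ¬vy =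
    Product.map ((v , u) ∷_) (Product.map (FootprintListOf-∷ vu u-undominated) there)
                (footprintList-through vs rest (All.∷ʳ⁺ y-undominated (¬-not ¬vy)) y-dominated)

  footprintList⇒ONSFrom : ∀ {prev} ps → IsFootprintList ps → All (Undominated prev ∘ proj₂) ps →
                          ONSFrom G prev (map proj₁ ps)
  footprintList⇒ONSFrom []             _                          _                           = tt
  footprintList⇒ONSFrom ((v , u) ∷ ps) (vu ∷ fps , v-misses ∷ misses) (u-undominated ∷ undominated) =
      (u , vu , u-undominated)
    , footprintList⇒ONSFrom ps (fps , misses) (All.zipWith (λ (w , v-w) → All.∷ʳ⁺ w v-w) (undominated , v-misses))

  transpose : List (Fin n × Fin n) → List (Fin n × Fin n)
  transpose ps = reverse (map swap ps)

  length-transpose : ∀ ps → length (transpose ps) ≡ length ps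
  length-transpose ps = trans (length-reverse (map swap ps)) (length-map swap ps)

  transpose-footprintList : ∀ {ps} → IsFootprintList ps → IsFootprintList (transpose ps)
  transpose-footprintList (fps , misses) =
      All-reverse⁺ (All.map⁺ (All.map (λ {p} vu → trans (sym G (proj₂ p) (proj₁ p)) vu) fps))
    , AllPairs-reverse⁺ (AllPairs.map⁺ (AllPairs.map (λ {p} {q} pq → trans (sym G (proj₂ q) (proj₁ p)) pq) misses))

  dominated⇒∈maxONS : ∀ {s y} → IsMaxONS G s → Any (λ v → InN G v y) s → ∃ λ t → IsMaxONS G t × y ∈ t
  dominated⇒∈maxONS {s} {y} ((_ , s-ons) , s-max) y-dominated
    with ps , (refl , fl , _) , y∈footprints ← footprintList-through s s-ons [] y-dominated =
    t , ((ONSFrom⇒Unique t t-ons , t-ons) , t-max) , y∈t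
    where
    t : List (Fin n)
    t = map proj₁ (transpose ps)
    t-ons : ONSFrom G [] t
    t-ons = footprintList⇒ONSFrom (transpose ps) (transpose-footprintList fl) (All.tabulate λ _ → [])
    length-s≡length-t : length s ≡ length t
    length-s≡length-t = begin
      length (map proj₁ ps)             ≡⟨ length-map proj₁ ps ⟩
      length ps                         ≡⟨ length-transpose ps ⟨
      length (transpose ps)             ≡⟨ length-map proj₁ (transpose ps) ⟨
      length t                          ∎
    t-max : ∀ t′ → IsONS G t′ → length t′ ≤ length t
    t-max t′ t′-ons = ≤-trans (s-max t′ t′-ons) (≤-reflexive length-s≡length-t)
    y∈t : y ∈ t
    y∈t = Any.map⁺ (Any.reverse⁺ (Any.map⁺ (Any.map⁻ y∈footprints)))

  ¬isolated⇒∈maxONS : ∀ {s x} → IsMaxONS G s → ¬ IsIsolated G x → ∃ λ t → IsMaxONS G t × x ∈ t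
  ¬isolated⇒∈maxONS {s} {x} s-max x-not-isolated
    with u , ¬xu≡false ← Fin.¬∀⟶∃¬ n _ (λ u → adj G x u ≟ false) x-not-isolated
    with any? (λ v → adj G v u ≟ true) s
  ... | yes u-dominated with t , t-max , u∈t ← dominated⇒∈maxONS s-max u-dominated =
    dominated⇒∈maxONS t-max (Any.map (λ { refl → trans (sym G u x) (¬-not ¬xu≡false) }) u∈t)
  ... | no u-undominated =
    contradiction (u , ¬-not ¬xu≡false , All.map ¬-not (All.¬Any⇒All¬ s u-undominated)) (maxONS⇒¬footprint s-max)

  nonIsolated : List (Fin n)
  nonIsolated = filter (∁? (isIsolated? G)) (allFin n)

  nonIsolated-Unique : Unique nonIsolated
  nonIsolated-Unique = Unique.filter⁺ (∁? (isIsolated? G)) (Unique.allFin⁺ n)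

  ∈-nonIsolated : ∀ {v} → v ∈ nonIsolated ⇔ (¬ IsIsolated G v)
  ∈-nonIsolated {v} =
    mk⇔ (proj₂ ∘ ∈-filter⁻ (∁? (isIsolated? G)) {xs = allFin n}) (∈-filter⁺ (∁? (isIsolated? G)) (∈-allFin v))

  length-nonIsolated : length nonIsolated ≡ n ∸ numIsolated G
  length-nonIsolated = begin
    length nonIsolated                                  ≡⟨ m+n∸m≡n (numIsolated G) _ ⟨
    numIsolated G + length nonIsolated ∸ numIsolated G ≡⟨ cong (_∸ numIsolated G)
                                                              (length-filter+length-filter-∁ (isIsolated? G) (allFin n)) ⟩
    length (allFin n) ∸ numIsolated G                   ≡⟨ cong (_∸ numIsolated G) (length-tabulate (λ v → v)) ⟩
    n ∸ numIsolated G                                   ∎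

  ONS⊆nonIsolated : ∀ {s} → IsONS G s → s ⊆ nonIsolated
  ONS⊆nonIsolated (_ , s-ons) v∈s = Equivalence.from ∈-nonIsolated (All.lookup (ONSFrom⇒¬isolated _ s-ons) v∈s)

  length-ONS≤ : ∀ {s} → IsONS G s → length s ≤ n ∸ numIsolated G
  length-ONS≤ s-ons@(s-unique , _) =
    subst (_ ≤_) length-nonIsolated (Unique-⊆⇒length≤ s-unique (ONS⊆nonIsolated s-ons))

  longONS⇔nonIsolated : ∀ {s} → IsONS G s → n ∸ numIsolated G ≤ length s → ∀ v → v ∈ s ⇔ v ∈ nonIsolated
  longONS⇔nonIsolated s-ons@(s-unique , _) long v = mk⇔ (ONS⊆nonIsolated s-ons)
    (Unique-⊆-length≥⇒⊇ Fin._≟_ s-unique (ONS⊆nonIsolated s-ons) (subst (_≤ _) (≡.sym length-nonIsolated) long))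

  maxONS⇒GrundyTotalDomNumber : ∀ {s} → IsMaxONS G s → IsGrundyTotalDomNumber G (length s)
  maxONS⇒GrundyTotalDomNumber {s} (s-ons , s-max) = (s , s-ons , refl) , s-max

  UniqueGTD⇒GrundyTotalDomNumber : UniqueGTD G → IsGrundyTotalDomNumber G (n ∸ numIsolated G)
  UniqueGTD⇒GrundyTotalDomNumber (S , (s , s-max , S⇔s) , S-unique) =
    subst (IsGrundyTotalDomNumber G) (≤-antisym (length-ONS≤ (proj₁ s-max)) nonIsolated≤s)
          (maxONS⇒GrundyTotalDomNumber s-max)
    where
    maxONS⊆s : ∀ {t} → IsMaxONS G t → t ⊆ s
    maxONS⊆s {t} t-max {v} v∈t = Equivalence.to (S⇔s v)
      (subst (v ∈ₛ_) (S-unique _ (t , t-max , ∈-toSubset t)) (Equivalence.from (∈-toSubset t v) v∈t))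
    nonIsolated⊆s : nonIsolated ⊆ s
    nonIsolated⊆s v∈ with t , t-max , v∈t ← ¬isolated⇒∈maxONS s-max (Equivalence.to ∈-nonIsolated v∈) =
      maxONS⊆s t-max v∈t
    nonIsolated≤s : n ∸ numIsolated G ≤ length s
    nonIsolated≤s = subst (_≤ length s) length-nonIsolated (Unique-⊆⇒length≤ nonIsolated-Unique nonIsolated⊆s)

  GrundyTotalDomNumber⇒UniqueGTD : IsGrundyTotalDomNumber G (n ∸ numIsolated G) → UniqueGTD G
  GrundyTotalDomNumber⇒UniqueGTD ((s , s-ons , length-s) , bound) =
    toSubset s , s-GTD , λ S′ S′-GTD → Subset-≡ λ v → ⇔.trans (GTD⇔nonIsolated S′-GTD v) (⇔.sym (GTD⇔nonIsolated s-GTD v))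
    where
    s-GTD : IsGrundyTotalDomSet G (toSubset s)
    s-GTD = s , (s-ons , λ t t-ons → subst (_ ≤_) (≡.sym length-s) (bound t t-ons)) , ∈-toSubset s
    GTD⇔nonIsolated : ∀ {S} → IsGrundyTotalDomSet G S → ∀ v → v ∈ₛ S ⇔ v ∈ nonIsolated
    GTD⇔nonIsolated (t , (t-ons , t-max) , S⇔t) v =
      ⇔.trans (S⇔t v) (longONS⇔nonIsolated t-ons (subst (_≤ _) length-s (t-max s s-ons)) v)

corollary5p3 : ∀ (n : ℕ) (G : Graph n) →
    UniqueGTD G ⇔ IsGrundyTotalDomNumber G (n ∸ numIsolated G)
corollary5p3 n G = mk⇔ (UniqueGTD⇒GrundyTotalDomNumber G) (GrundyTotalDomNumber⇒UniqueGTD G)
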